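{- Let $G$ be a finite bipartite graph with $n$ vertices whose number of isolated vertices is not equal to $1$. Then $\alpha(G)>n/2$ if and only if $\xi(G)\geq 2$.
   Context: $\alpha(G)$ is the maximum size of a stable set of $G$; $\Omega(G)$ is the set of maximum stable sets; $core(G)=\bigcap\{S:S\in\Omega(G)\}$ and $\xi(G)=|core(G)|$. -}

module Defs where

open import Data.Bool using (Bool; true; false; not; _∧_; if_then_else_)
open import Data.Nat using (ℕ; zero; suc; _⊔_; _≡ᵇ_)
open import Data.Fin using (Fin)
open import Data.Fin.Subset using (Subset; _∩_; ⊤; ∣_∣)
open import Data.Vec using ([]; _∷_; lookup)
open import Data.List using (List; []; _∷_; [_]; map; _++_; filterᵇ; foldr; length; allFin)
open import Relation.Binary.PropositionalEquality using (_≡_; _≢_)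
open import Data.Product using (∃)

every : ∀ {A : Set} → (A → Bool) → List A → Bool
every p = foldr (λ x b → p x ∧ b) true

record Graph (n : ℕ) : Set where
  field
    adj    : Fin n → Fin n → Bool
    sym    : ∀ u v → adj u v ≡ adj v u
    irrefl : ∀ v → adj v v ≡ false
open Graph public

Bipartite : ∀ {n} → Graph n → Set
Bipartite {n} G = ∃ λ (c : Fin n → Bool) → ∀ u v → adj G u v ≡ true → c u ≢ c v

isIsolated : ∀ {n} → Graph n → Fin n → Bool
isIsolated {n} G v = every (λ u → not (adj G v u)) (allFin n)

numIsolated : ∀ {n} → Graph n → ℕ
numIsolated {n} G = length (filterᵇ (isIsolated G) (allFin n))

isStable : ∀ {n} → Graph n → Subset n → Bool
isStable {n} G S =
  every (λ u → every (λ v → not (lookup S u ∧ lookup S v ∧ adj G u v)) (allFin n)) (allFin n)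

allSubsets : ∀ n → List (Subset n)
allSubsets zero = [ [] ]
allSubsets (suc n) = map (true ∷_) (allSubsets n) ++ map (false ∷_) (allSubsets n)

stableSets : ∀ {n} → Graph n → List (Subset n)
stableSets {n} G = filterᵇ (isStable G) (allSubsets n)

α : ∀ {n} → Graph n → ℕ
α G = foldr (λ S m → ∣ S ∣ ⊔ m) 0 (stableSets G)

Ω : ∀ {n} → Graph n → List (Subset n)
Ω G = filterᵇ (λ S → ∣ S ∣ ≡ᵇ α G) (stableSets G)

core : ∀ {n} → Graph n → Subset n
core G = foldr _∩_ ⊤ (Ω G)

ξ : ∀ {n} → Graph n → ℕ
ξ G = ∣ core G ∣

-- Fix a proper 2-colouring c of G. For two maximum stable sets S and T, the join that takes S ∪ T
-- on the colour class c and S ∩ T off it is stable, and so is its mirror image with the classes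
-- swapped; together they have |S| + |T| elements, so both are maximum again. If the core is empty,
-- choose for every vertex x a maximum stable set missing x and join them all: off the class c the
-- result lies in all the chosen sets, hence misses every vertex there. This gives a maximum stable
-- set inside each colour class, so 2α ≤ n. Conversely, if 2α ≤ n both colour classes are maximum
-- stable sets, and the core is empty.
-- If core(G) = {v}, removing v sends the maximum stable sets of G to stable subsets of V ∖ N[v]
-- of the largest possible size α − 1, and no vertex lies in all of them; the same argument inside
-- V ∖ N[v] gives 2(α − 1) ≤ n − 2 as soon as v has a neighbour. Isolated vertices lie in the core,
-- so if v is isolated it is the only isolated vertex.

module Submission where

open import Defs
open import Data.Nat using (ℕ; _<_; _≤_; _*_)
open import Relation.Binary.PropositionalEquality using (_≢_)
open import Function.Bundles using (_⇔_)

open import Data.Bool using (Bool; true; false; not; _∧_; _∨_; if_then_else_; T?)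
import Data.Bool as Bool
open import Data.Bool.Properties using (not-injective; ¬-not; T-≡)
open import Data.Empty using (⊥; ⊥-elim)
open import Data.Fin using (Fin; zero; suc; _≟_)
open import Data.Fin.Properties using (¬∀⟶∃¬)
open import Data.Fin.Subset using (Subset; ∣_∣; ⋂)
open import Data.List using (List; []; _∷_; foldr; length; filterᵇ; map; allFin)
import Data.List as List
open import Data.List.Membership.Propositional using (_∈_)
open import Data.List.Membership.Propositional.Properties
  using (∈-filter⁺; ∈-filter⁻; ∈-map⁺; ∈-++⁺ˡ; ∈-++⁺ʳ)
open import Data.List.Relation.Unary.All using (All; []; _∷_)
import Data.List.Relation.Unary.All.Properties as All
open import Data.List.Relation.Unary.Any using (here; there)
open import Data.Nat using (zero; suc; pred; z≤n; s≤s; _+_; _⊔_; _≡ᵇ_; >-nonZero)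
open import Data.Nat.Properties
  using ( +-identityʳ; +-assoc; +-comm; +-mono-≤; +-monoˡ-≤; +-monoʳ-≤; +-cancelʳ-≤; *-suc
        ; ≤-refl; ≤-reflexive; ≤-trans; ≤-antisym; m≤m⊔n; m≤n⊔m; ⊔-sel; 1+n≰n; ≰⇒>; <⇒≱
        ; m<n⇒n≢0; n≤1⇒n≡0∨n≡1; suc[m]≤n⇒m≤pred[n]; suc-pred; ≡ᵇ⇒≡; ≡⇒≡ᵇ
        ; +-commutativeSemigroup; module ≤-Reasoning )
open import Algebra.Properties.CommutativeSemigroup +-commutativeSemigroup
  using (interchange; xy∙z≈zy∙x)
open import Data.Product using (Σ; ∃; _×_; _,_; proj₁; proj₂)
import Data.Product as Product
open import Data.Sum using (_⊎_; inj₁; inj₂; [_,_])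
open import Data.Vec using ([]; _∷_; lookup; tabulate)
open import Data.Vec.Properties using (lookup∘tabulate; lookup-zipWith; lookup-replicate)
open import Data.Vec.Functional using (updateAt)
open import Data.Vec.Functional.Properties using (updateAt-updates; updateAt-minimal)
open import Function using (_∘_; const; id)
open import Function.Bundles using (mk⇔; Equivalence)
import Relation.Binary.PropositionalEquality as ≡
open ≡ using (_≡_; refl; trans; cong; cong₂; subst; subst₂; module ≡-Reasoning)
open import Relation.Nullary using (yes; no)

false≢true : false ≢ true
false≢true ()

∧-true⁻ : ∀ {a b} → a ∧ b ≡ true → a ≡ true × b ≡ true
∧-true⁻ {true} b≡true = refl , b≡true

∧-false⁻ : ∀ {a b} → a ∧ b ≡ false → a ≡ false ⊎ b ≡ false
∧-false⁻ {false} _       = inj₁ refl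
∧-false⁻ {true}  b≡false = inj₂ b≡false

∨-true⁻ : ∀ {a b} → a ∨ b ≡ true → a ≡ true ⊎ b ≡ true
∨-true⁻ {true}  _       = inj₁ refl
∨-true⁻ {false} b≡true = inj₂ b≡true

not-true⁻ : ∀ {a} → not a ≡ true → a ≡ false
not-true⁻ {false} _ = refl

2*m≡m+m : ∀ m → 2 * m ≡ m + m
2*m≡m+m m = cong (m +_) (+-identityʳ m)

m≤o∧n≤o∧o+o≤m+n⇒m≡o : ∀ {m n o} → m ≤ o → n ≤ o → o + o ≤ m + n → m ≡ o
m≤o∧n≤o∧o+o≤m+n⇒m≡o {m} {n} {o} m≤o n≤o o+o≤m+n =
  ≤-antisym m≤o (+-cancelʳ-≤ o o m (≤-trans o+o≤m+n (+-monoʳ-≤ m n≤o)))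

every⁻ : ∀ {A : Set} {p : A → Bool} xs → every p xs ≡ true → All (λ x → p x ≡ true) xs
every⁻ []       _ = []
every⁻ (x ∷ xs) e = let px , pxs = ∧-true⁻ e in px ∷ every⁻ xs pxs

every⁺ : ∀ {A : Set} {p : A → Bool} {xs} → All (λ x → p x ≡ true) xs → every p xs ≡ true
every⁺ []           = refl
every⁺ (px ∷ pxs) rewrite px = every⁺ pxs

every-allFin⁻ : ∀ {n} {p : Fin n → Bool} → every p (allFin n) ≡ true → ∀ x → p x ≡ true
every-allFin⁻ e = All.tabulate⁻ (every⁻ _ e)

every-allFin⁺ : ∀ {n} {p : Fin n → Bool} → (∀ x → p x ≡ true) → every p (allFin n) ≡ true
every-allFin⁺ h = every⁺ (All.tabulate⁺ h)

maxOf : ∀ {A : Set} → (A → ℕ) → List A → ℕ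
maxOf f = foldr (λ x m → f x ⊔ m) 0

≤-maxOf : ∀ {A : Set} (f : A → ℕ) {x xs} → x ∈ xs → f x ≤ maxOf f xs
≤-maxOf f (here refl) = m≤m⊔n _ _
≤-maxOf f (there x∈)  = ≤-trans (≤-maxOf f x∈) (m≤n⊔m _ _)

maxOf-attained : ∀ {A : Set} (f : A → ℕ) xs →
                 maxOf f xs ≡ 0 ⊎ ∃ λ x → x ∈ xs × f x ≡ maxOf f xs
maxOf-attained f []       = inj₁ refl
maxOf-attained f (x ∷ xs) with ⊔-sel (f x) (maxOf f xs)
... | inj₁ fx = inj₂ (x , here refl , ≡.sym fx)
... | inj₂ rest with maxOf-attained f xs
...   | inj₁ rest≡0          = inj₁ (trans rest rest≡0)
...   | inj₂ (y , y∈ , fy≡) = inj₂ (y , there y∈ , trans fy≡ (≡.sym rest))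

-- Finite sets are Boolean predicates on Fin n.

bit : Bool → ℕ
bit false = 0
bit true  = 1

count : ∀ {n} → (Fin n → Bool) → ℕ
count {zero}  P = 0
count {suc n} P = bit (P zero) + count (P ∘ suc)

_⊆_ : ∀ {n} → (Fin n → Bool) → (Fin n → Bool) → Set
P ⊆ Q = ∀ x → P x ≡ true → Q x ≡ true

∅ full : ∀ {n} → Fin n → Bool
∅    _ = false
full _ = true

⊆-∧ : ∀ {n} {P Q R : Fin n → Bool} → P ⊆ Q → P ⊆ R → P ⊆ (λ x → Q x ∧ R x)
⊆-∧ P⊆Q P⊆R x Px rewrite P⊆Q x Px = P⊆R x Px

count-∅ : ∀ {n} → count {n} ∅ ≡ 0
count-∅ {zero}  = refl
count-∅ {suc n} = count-∅ {n}

count-full : ∀ {n} → count {n} full ≡ n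
count-full {zero}  = refl
count-full {suc n} = cong suc (count-full {n})

bit-mono : ∀ {a b} → (a ≡ true → b ≡ true) → bit a ≤ bit b
bit-mono {false} _   = z≤n
bit-mono {true}  a⇒b rewrite a⇒b refl = ≤-refl

count-mono : ∀ {n} {P Q : Fin n → Bool} → P ⊆ Q → count P ≤ count Q
count-mono {zero}  _   = z≤n
count-mono {suc n} P⊆Q = +-mono-≤ (bit-mono (P⊆Q zero)) (count-mono (P⊆Q ∘ suc))

count-+-cong : ∀ {n} (P Q R S : Fin n → Bool) →
               (∀ x → bit (P x) + bit (Q x) ≡ bit (R x) + bit (S x)) →
               count P + count Q ≡ count R + count S
count-+-cong {zero}  _ _ _ _ _  = refl
count-+-cong {suc n} P Q R S eq =
  trans (interchange (bit (P zero)) (count (P ∘ suc)) (bit (Q zero)) (count (Q ∘ suc)))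
        (trans (cong₂ _+_ (eq zero)
                          (count-+-cong (P ∘ suc) (Q ∘ suc) (R ∘ suc) (S ∘ suc) (eq ∘ suc)))
               (interchange (bit (R zero)) (bit (S zero)) (count (R ∘ suc)) (count (S ∘ suc))))

count-∧-split : ∀ {n} (P Q : Fin n → Bool) →
                count (λ x → P x ∧ Q x) + count (λ x → P x ∧ not (Q x)) ≡ count P
count-∧-split {n} P Q =
  trans (count-+-cong (λ x → P x ∧ Q x) (λ x → P x ∧ not (Q x)) P ∅ (λ x → bit-split (P x) (Q x)))
        (trans (cong (count P +_) (count-∅ {n})) (+-identityʳ (count P)))
  where
  bit-split : ∀ p q → bit (p ∧ q) + bit (p ∧ not q) ≡ bit p + bit false
  bit-split false _     = refl
  bit-split true  true  = refl
  bit-split true  false = refl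

count-complement : ∀ {n} (P : Fin n → Bool) → count P + count (not ∘ P) ≡ n
count-complement P = trans (count-∧-split full P) count-full

count-witness : ∀ {n} (P : Fin n → Bool) → 0 < count P → ∃ λ v → P v ≡ true
count-witness {suc n} P pos with P zero in P0
... | true  = zero , P0
... | false = Product.map suc id (count-witness (P ∘ suc) pos)

count-updateAt : ∀ {n} (P : Fin n → Bool) v b →
                 count (updateAt P v (const b)) + bit (P v) ≡ count P + bit b
count-updateAt P zero    b = xy∙z≈zy∙x (bit b) (count (P ∘ suc)) (bit (P zero))
count-updateAt P (suc v) b =
  trans (+-assoc (bit (P zero)) _ _)
        (trans (cong (bit (P zero) +_) (count-updateAt (P ∘ suc) v b))
               (≡.sym (+-assoc (bit (P zero)) _ _)))

insert remove : ∀ {n} → Fin n → (Fin n → Bool) → Fin n → Bool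
insert v P = updateAt P v (const true)
remove v P = updateAt P v (const false)

count-insert : ∀ {n} (P : Fin n → Bool) {v} → P v ≡ false → count (insert v P) ≡ suc (count P)
count-insert P {v} Pv≡false = begin
  count (insert v P)             ≡⟨ +-identityʳ _ ⟨
  count (insert v P) + bit false ≡⟨ cong (λ b → count (insert v P) + bit b) Pv≡false ⟨
  count (insert v P) + bit (P v) ≡⟨ count-updateAt P v true ⟩
  count P + 1                    ≡⟨ +-comm (count P) 1 ⟩
  suc (count P)                  ∎
  where open ≡-Reasoning

count-remove : ∀ {n} (P : Fin n → Bool) {v} → P v ≡ true → suc (count (remove v P)) ≡ count P
count-remove P {v} Pv≡true = begin
  suc (count (remove v P))       ≡⟨ +-comm 1 _ ⟩
  count (remove v P) + bit true  ≡⟨ cong (λ b → count (remove v P) + bit b) Pv≡true ⟨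
  count (remove v P) + bit (P v) ≡⟨ count-updateAt P v false ⟩
  count P + 0                    ≡⟨ +-identityʳ _ ⟩
  count P                        ∎
  where open ≡-Reasoning

∈-insert⁻ : ∀ {n} {P : Fin n → Bool} {v x} → insert v P x ≡ true → x ≡ v ⊎ P x ≡ true
∈-insert⁻ {P = P} {v} {x} e with x ≟ v
... | yes x≡v = inj₁ x≡v
... | no  x≢v = inj₂ (trans (≡.sym (updateAt-minimal x v P x≢v)) e)

remove-≢ : ∀ {n} (P : Fin n → Bool) {v x} → x ≢ v → remove v P x ≡ P x
remove-≢ P {v} {x} = updateAt-minimal x v P

∈-remove⁻ : ∀ {n} {P : Fin n → Bool} {v x} → remove v P x ≡ true → x ≢ v × P x ≡ true
∈-remove⁻ {P = P} {v} {x} e with x ≟ v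
... | yes refl = ⊥-elim (false≢true (trans (≡.sym (updateAt-updates v P)) e))
... | no  x≢v  = x≢v , trans (≡.sym (remove-≢ P x≢v)) e

remove-⊆ : ∀ {n} {P : Fin n → Bool} {v} → remove v P ⊆ P
remove-⊆ {P = P} {v} x e = proj₂ (∈-remove⁻ {P = P} {v} e)

count-pos : ∀ {n} {P : Fin n → Bool} {v} → P v ≡ true → 0 < count P
count-pos {P = P} Pv = subst (0 <_) (count-remove P Pv) (s≤s z≤n)

count-two : ∀ {n} {P : Fin n → Bool} {u v} → P u ≡ true → P v ≡ true → u ≢ v → 2 ≤ count P
count-two {P = P} {u} {v} Pu Pv u≢v =
  subst (2 ≤_) (count-remove P Pu) (s≤s (count-pos {P = remove u P} v∈))
  where
  v∈ : remove u P v ≡ true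
  v∈ = trans (remove-≢ P (u≢v ∘ ≡.sym)) Pv

count≡0⇒false : ∀ {n} {P : Fin n → Bool} → count P ≡ 0 → ∀ x → P x ≡ false
count≡0⇒false {P = P} ∣P∣≡0 x = ¬-not λ Px → m<n⇒n≢0 (count-pos {P = P} Px) ∣P∣≡0

count≡1⇒singleton : ∀ {n} {P : Fin n → Bool} → count P ≡ 1 →
                    ∃ λ v → P v ≡ true × (∀ x → P x ≡ true → x ≡ v)
count≡1⇒singleton {P = P} ∣P∣≡1 with count-witness P (subst (0 <_) (≡.sym ∣P∣≡1) (s≤s z≤n))
... | v , Pv = v , Pv , unique
  where
  unique : ∀ x → P x ≡ true → x ≡ v
  unique x Px with x ≟ v
  ... | yes x≡v = x≡v
  ... | no  x≢v = ⊥-elim (1+n≰n (subst (2 ≤_) ∣P∣≡1 (count-two Px Pv x≢v)))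

length-filterᵇ-tabulate : ∀ {A : Set} {m} (p : A → Bool) (f : Fin m → A) →
                          length (filterᵇ p (List.tabulate f)) ≡ count (p ∘ f)
length-filterᵇ-tabulate {m = zero}  p f = refl
length-filterᵇ-tabulate {m = suc m} p f with p (f zero)
... | true  = cong suc (length-filterᵇ-tabulate p (f ∘ suc))
... | false = length-filterᵇ-tabulate p (f ∘ suc)

-- Bipartite joins

join : ∀ {n} → (Fin n → Bool) → (Fin n → Bool) → (Fin n → Bool) → Fin n → Bool
join c S T x = if c x then S x ∨ T x else S x ∧ T x

join-⊆ : ∀ {n} {c S T W : Fin n → Bool} → S ⊆ W → T ⊆ W → join c S T ⊆ W
join-⊆ {c = c} {S} S⊆W T⊆W x ∈x with c x
... | true  = [ S⊆W x , T⊆W x ] (∨-true⁻ {S x} ∈x)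
... | false = S⊆W x (proj₁ (∧-true⁻ ∈x))

join-∩ : ∀ {n} {c S T : Fin n → Bool} {x} → c x ≡ false → join c S T x ≡ true →
         S x ≡ true × T x ≡ true
join-∩ {c = c} {x = x} cx ∈x with c x | cx
... | false | refl = ∧-true⁻ ∈x

count-join : ∀ {n} (c S T : Fin n → Bool) →
             count (join c S T) + count (join (not ∘ c) S T) ≡ count S + count T
count-join c S T =
  count-+-cong (join c S T) (join (not ∘ c) S T) S T (λ x → bit-join (c x) (S x) (T x))
  where
  bit-∨-∧ : ∀ s t → bit (s ∨ t) + bit (s ∧ t) ≡ bit s + bit t
  bit-∨-∧ false false = refl
  bit-∨-∧ false true  = refl
  bit-∨-∧ true  false = refl
  bit-∨-∧ true  true  = refl
  bit-join : ∀ d s t → bit (if d then s ∨ t else s ∧ t) + bit (if not d then s ∨ t else s ∧ t)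
                     ≡ bit s + bit t
  bit-join true  s t = bit-∨-∧ s t
  bit-join false s t = trans (+-comm (bit (s ∧ t)) _) (bit-∨-∧ s t)

joinAll : ∀ {n m} → (Fin n → Bool) → (Fin n → Bool) → (Fin m → Fin n → Bool) → Fin n → Bool
joinAll {m = zero}  c S₀ F = S₀
joinAll {m = suc m} c S₀ F = join c (F zero) (joinAll c S₀ (F ∘ suc))

joinAll-closed : ∀ {n m} {c : Fin n → Bool} {Good : (Fin n → Bool) → Set} →
                 (∀ S T → Good S → Good T → Good (join c S T)) →
                 ∀ {S₀ F} → Good S₀ → (∀ (i : Fin m) → Good (F i)) → Good (joinAll c S₀ F)
joinAll-closed {m = zero}  closed good₀ good = good₀
joinAll-closed {m = suc m} closed good₀ good =
  closed _ _ (good zero) (joinAll-closed closed good₀ (good ∘ suc))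

joinAll-∩ : ∀ {n m} {c S₀ : Fin n → Bool} {F : Fin m → Fin n → Bool} {x} →
            c x ≡ false → joinAll c S₀ F x ≡ true → ∀ i → F i x ≡ true
joinAll-∩ {m = suc m} {c} {S₀} {F} {x} cx ∈x = λ where
    zero    → proj₁ ∈F₀×∈rest
    (suc i) → joinAll-∩ {F = F ∘ suc} cx (proj₂ ∈F₀×∈rest) i
  where
  ∈F₀×∈rest : F zero x ≡ true × joinAll c S₀ (F ∘ suc) x ≡ true
  ∈F₀×∈rest = join-∩ {c = c} {F zero} {joinAll c S₀ (F ∘ suc)} cx ∈x

-- Stable sets, α, Ω and core

∣∣≡count : ∀ {n} (S : Subset n) → ∣ S ∣ ≡ count (lookup S)
∣∣≡count []          = refl
∣∣≡count (true ∷ S)  = cong suc (∣∣≡count S)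
∣∣≡count (false ∷ S) = ∣∣≡count S

∣tabulate∣≡count : ∀ {n} (P : Fin n → Bool) → ∣ tabulate P ∣ ≡ count P
∣tabulate∣≡count {zero}  P = refl
∣tabulate∣≡count {suc n} P with P zero
... | true  = cong suc (∣tabulate∣≡count (P ∘ suc))
... | false = ∣tabulate∣≡count (P ∘ suc)

∈-allSubsets : ∀ {n} (S : Subset n) → S ∈ allSubsets n
∈-allSubsets []                  = here refl
∈-allSubsets {suc n} (true ∷ S)  = ∈-++⁺ˡ (∈-map⁺ (true ∷_) (∈-allSubsets S))
∈-allSubsets {suc n} (false ∷ S) =
  ∈-++⁺ʳ (map (true ∷_) (allSubsets n)) (∈-map⁺ (false ∷_) (∈-allSubsets S))

∈-⋂ : ∀ {n} (Ss : List (Subset n)) {S x} → lookup (⋂ Ss) x ≡ true → S ∈ Ss → lookup S x ≡ true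
∈-⋂ (T ∷ Ss) {x = x} x∈⋂ S∈ with ∧-true⁻ (trans (≡.sym (lookup-zipWith _∧_ x T (⋂ Ss))) x∈⋂) | S∈
... | Tx , _    | here refl  = Tx
... | _ , x∈⋂Ss | there S∈Ss = ∈-⋂ Ss x∈⋂Ss S∈Ss

∉-⋂ : ∀ {n} (Ss : List (Subset n)) {x} → lookup (⋂ Ss) x ≡ false →
      ∃ λ S → S ∈ Ss × lookup S x ≡ false
∉-⋂ []       {x} x∉⋂ = ⊥-elim (false≢true (trans (≡.sym x∉⋂) (lookup-replicate x true)))
∉-⋂ (S ∷ Ss) {x} x∉⋂ with ∧-false⁻ (trans (≡.sym (lookup-zipWith _∧_ x S (⋂ Ss))) x∉⋂)
... | inj₁ Sx    = S , here refl , Sx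
... | inj₂ x∉⋂Ss = let T , T∈ , Tx = ∉-⋂ Ss x∉⋂Ss in T , there T∈ , Tx

module _ {n} (G : Graph n) where

  Stable : (Fin n → Bool) → Set
  Stable P = ∀ u v → adj G u v ≡ true → P u ≡ true → P v ≡ true → ⊥

  ProperColouring : (Fin n → Bool) → Set
  ProperColouring c = ∀ u v → adj G u v ≡ true → c u ≢ c v

  StableSubset : (Fin n → Bool) → ℕ → (Fin n → Bool) → Set
  StableSubset W a P = Stable P × P ⊆ W × count P ≡ a

  Maximum : (Fin n → Bool) → Set
  Maximum = StableSubset full (α G)

  closedNbhdᶜ : Fin n → Fin n → Bool
  closedNbhdᶜ v = remove v (not ∘ adj G v)

  adj-sym : ∀ {u v} → adj G u v ≡ true → adj G v u ≡ true
  adj-sym {u} {v} e = trans (sym G v u) e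

  Stable⇒nonadjacent : ∀ {P u v} → Stable P → P u ≡ true → P v ≡ true → adj G u v ≡ false
  Stable⇒nonadjacent {u = u} {v} st Pu Pv = ¬-not λ e → st u v e Pu Pv

  Stable-⊆ : ∀ {P Q} → P ⊆ Q → Stable Q → Stable P
  Stable-⊆ P⊆Q stQ u v e Pu Pv = stQ u v e (P⊆Q u Pu) (P⊆Q v Pv)

  insert-Stable : ∀ {P v} → Stable P → (∀ y → P y ≡ true → adj G v y ≡ false) → Stable (insert v P)
  insert-Stable {P} {v} st v≁P x y e ∈x ∈y with ∈-insert⁻ {P = P} {v} ∈x | ∈-insert⁻ {P = P} {v} ∈y
  ... | inj₁ refl | inj₁ refl = false≢true (trans (≡.sym (irrefl G v)) e)
  ... | inj₁ refl | inj₂ Py   = false≢true (trans (≡.sym (v≁P y Py)) e)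
  ... | inj₂ Px   | inj₁ refl = false≢true (trans (≡.sym (v≁P x Px)) (adj-sym e))
  ... | inj₂ Px   | inj₂ Py   = st x y e Px Py

  ProperColouring-not : ∀ {c} → ProperColouring c → ProperColouring (not ∘ c)
  ProperColouring-not proper u v e = proper u v e ∘ not-injective

  colourClass-Stable : ∀ {c} → ProperColouring c → Stable c
  colourClass-Stable proper u v e cu cv = proper u v e (trans cu (≡.sym cv))

  ∪-∩-nonadjacent : ∀ {S T x y} → Stable S → Stable T →
                    adj G x y ≡ true → S x ∨ T x ≡ true → S y ∧ T y ≡ true → ⊥
  ∪-∩-nonadjacent {S} {x = x} stS stT e ∈x ∈y with ∨-true⁻ {S x} ∈x | ∧-true⁻ ∈y
  ... | inj₁ Sx | Sy , _  = stS _ _ e Sx Sy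
  ... | inj₂ Tx | _  , Ty = stT _ _ e Tx Ty

  join-Stable : ∀ {c S T} → ProperColouring c → Stable S → Stable T → Stable (join c S T)
  join-Stable {c} {S} {T} proper stS stT u v e ∈u ∈v with c u in cu | c v in cv
  ... | true  | true  = proper u v e (trans cu (≡.sym cv))
  ... | false | false = proper u v e (trans cu (≡.sym cv))
  ... | true  | false = ∪-∩-nonadjacent {S} {T} stS stT e ∈u ∈v
  ... | false | true  = ∪-∩-nonadjacent {S} {T} stS stT (adj-sym e) ∈v ∈u

  -- The induced subgraph G[W] is not formed: a plays the role of α(G[W]).
  module _ {W : Fin n → Bool} {a : ℕ} (bounded : ∀ {P} → Stable P → P ⊆ W → count P ≤ a) where

    join-StableSubset : ∀ {c S T} → ProperColouring c →
                        StableSubset W a S → StableSubset W a T → StableSubset W a (join c S T)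
    join-StableSubset {c} {S} {T} proper (stS , S⊆W , ∣S∣) (stT , T⊆W , ∣T∣) =
      join-Stable proper stS stT , join-⊆ {c = c} {S} {T} S⊆W T⊆W ,
      m≤o∧n≤o∧o+o≤m+n⇒m≡o (join-bounded proper) (join-bounded (ProperColouring-not proper)) tight
      where
      join-bounded : ∀ {d} → ProperColouring d → count (join d S T) ≤ a
      join-bounded {d} proper =
        bounded (join-Stable proper stS stT) (join-⊆ {c = d} {S} {T} S⊆W T⊆W)
      tight : a + a ≤ count (join c S T) + count (join (not ∘ c) S T)
      tight = ≤-reflexive (trans (cong₂ _+_ (≡.sym ∣S∣) (≡.sym ∣T∣)) (≡.sym (count-join c S T)))

    emptyCore⇒2a≤count : ∀ {c} → ProperColouring c → ∀ {S₀} → StableSubset W a S₀ →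
                         (∀ {x} → W x ≡ true → ∃ λ P → StableSubset W a P × P x ≡ false) →
                         2 * a ≤ count W
    emptyCore⇒2a≤count {c} proper {S₀} good₀ avoid = begin
      2 * a
        ≡⟨ 2*m≡m+m a ⟩
      a + a
        ≡⟨ cong₂ _+_ (size proper) (size proper′) ⟨
      count (joinAll c S₀ F) + count (joinAll (not ∘ c) S₀ F)
        ≤⟨ +-mono-≤ (count-mono (inside proper)) (count-mono (inside proper′)) ⟩
      count (λ x → W x ∧ c x) + count (λ x → W x ∧ not (c x))
        ≡⟨ count-∧-split W c ⟩
      count W
        ∎
      where
      open ≤-Reasoning
      proper′ : ProperColouring (not ∘ c)
      proper′ = ProperColouring-not proper
      avoider : ∀ x → Σ (Fin n → Bool) λ P → StableSubset W a P × (W x ≡ true → P x ≡ false)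
      avoider x with W x in Wx
      ... | true  = let P , good , Px = avoid Wx in P , good , const Px
      ... | false = S₀ , good₀ , λ ()
      F : Fin n → Fin n → Bool
      F = proj₁ ∘ avoider
      good : ∀ {d} → ProperColouring d → StableSubset W a (joinAll d S₀ F)
      good {d} proper =
        joinAll-closed {c = d} {Good = StableSubset W a}
                       (λ S T → join-StableSubset {S = S} {T} proper) good₀ (proj₁ ∘ proj₂ ∘ avoider)
      size : ∀ {d} → ProperColouring d → count (joinAll d S₀ F) ≡ a
      size proper = proj₂ (proj₂ (good proper))
      colourClass : ∀ {d} → ProperColouring d → joinAll d S₀ F ⊆ d
      colourClass {d} proper x ∈x with d x in dx
      ... | true  = refl
      ... | false = trans (≡.sym (proj₂ (proj₂ (avoider x)) (proj₁ (proj₂ (good proper)) x ∈x)))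
                          (joinAll-∩ {F = F} dx ∈x x)
      inside : ∀ {d} → ProperColouring d → joinAll d S₀ F ⊆ (λ x → W x ∧ d x)
      inside proper = ⊆-∧ (proj₁ (proj₂ (good proper))) (colourClass proper)

  isStable⇒Stable : ∀ S → isStable G S ≡ true → Stable (lookup S)
  isStable⇒Stable S stable u v e Su Sv = nand (every-allFin⁻ (every-allFin⁻ stable u) v) Su Sv e
    where
    nand : ∀ {a b c} → not (a ∧ b ∧ c) ≡ true → a ≡ true → b ≡ true → c ≡ true → ⊥
    nand () refl refl refl

  Stable⇒isStable : ∀ S → Stable (lookup S) → isStable G S ≡ true
  Stable⇒isStable S st = every-allFin⁺ λ u → every-allFin⁺ λ v → nand (st u v)
    where
    nand : ∀ {a b c} → (c ≡ true → a ≡ true → b ≡ true → ⊥) → not (a ∧ b ∧ c) ≡ true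
    nand {false}               _ = refl
    nand {true} {false}        _ = refl
    nand {true} {true} {false} _ = refl
    nand {true} {true} {true}  h = ⊥-elim (h refl refl refl)

  ∈stableSets⁻ : ∀ {S} → S ∈ stableSets G → Stable (lookup S)
  ∈stableSets⁻ {S} S∈ =
    isStable⇒Stable S
      (Equivalence.to T-≡ (proj₂ (∈-filter⁻ (T? ∘ isStable G) {xs = allSubsets n} S∈)))

  ∈stableSets⁺ : ∀ {P} → Stable P → tabulate P ∈ stableSets G
  ∈stableSets⁺ {P} st =
    ∈-filter⁺ (T? ∘ isStable G) (∈-allSubsets (tabulate P))
      (Equivalence.from T-≡ (Stable⇒isStable (tabulate P) (Stable-⊆ tabulate⊆ st)))
    where
    tabulate⊆ : lookup (tabulate P) ⊆ P
    tabulate⊆ x = trans (≡.sym (lookup∘tabulate P x))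

  Stable⇒≤α : ∀ {P} → Stable P → count P ≤ α G
  Stable⇒≤α {P} st = subst (_≤ α G) (∣tabulate∣≡count P) (≤-maxOf ∣_∣ (∈stableSets⁺ st))

  extend-≤α : ∀ {P v} → Stable P → P v ≡ false → (∀ y → P y ≡ true → adj G v y ≡ false) →
              suc (count P) ≤ α G
  extend-≤α {P} st Pv v≁P = subst (_≤ α G) (count-insert P Pv) (Stable⇒≤α (insert-Stable st v≁P))

  maximum-exists : ∃ Maximum
  maximum-exists with maxOf-attained ∣_∣ (stableSets G)
  ... | inj₁ α≡0            = ∅ , (λ _ _ _ ()) , (λ _ ()) , trans (count-∅ {n}) (≡.sym α≡0)
  ... | inj₂ (S , S∈ , ∣S∣≡α) =
    lookup S , ∈stableSets⁻ S∈ , (λ _ _ → refl) , trans (≡.sym (∣∣≡count S)) ∣S∣≡α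

  ∈Ω⁻ : ∀ {S} → S ∈ Ω G → Maximum (lookup S)
  ∈Ω⁻ {S} S∈Ω with ∈-filter⁻ (T? ∘ λ S → ∣ S ∣ ≡ᵇ α G) {xs = stableSets G} S∈Ω
  ... | S∈ , ∣S∣≡ᵇα =
    ∈stableSets⁻ S∈ , (λ _ _ → refl) , trans (≡.sym (∣∣≡count S)) (≡ᵇ⇒≡ _ _ ∣S∣≡ᵇα)

  Maximum⇒∈Ω : ∀ {P} → Maximum P → tabulate P ∈ Ω G
  Maximum⇒∈Ω {P} (st , _ , ∣P∣) =
    ∈-filter⁺ (T? ∘ λ S → ∣ S ∣ ≡ᵇ α G) (∈stableSets⁺ st)
      (≡⇒≡ᵇ _ _ (trans (∣tabulate∣≡count P) ∣P∣))

  core⊆Maximum : ∀ {P x} → lookup (core G) x ≡ true → Maximum P → P x ≡ true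
  core⊆Maximum {P} {x} x∈core max =
    trans (≡.sym (lookup∘tabulate P x)) (∈-⋂ (Ω G) x∈core (Maximum⇒∈Ω max))

  ∉core⇒avoided : ∀ {x} → lookup (core G) x ≡ false → ∃ λ P → Maximum P × P x ≡ false
  ∉core⇒avoided x∉core = let S , S∈Ω , Sx = ∉-⋂ (Ω G) x∉core in lookup S , ∈Ω⁻ S∈Ω , Sx

  ξ≡count : ξ G ≡ count (lookup (core G))
  ξ≡count = ∣∣≡count (core G)

  numIsolated≡count : numIsolated G ≡ count (isIsolated G)
  numIsolated≡count = length-filterᵇ-tabulate (isIsolated G) id

  isolated⇒nonadjacent : ∀ {v} → isIsolated G v ≡ true → ∀ u → adj G v u ≡ false
  isolated⇒nonadjacent iso u = not-true⁻ (every-allFin⁻ iso u)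

  nonIsolated⇒neighbour : ∀ {v} → isIsolated G v ≡ false → ∃ λ u → adj G v u ≡ true
  nonIsolated⇒neighbour {v} ¬iso =
    Product.map₂ ¬-not (¬∀⟶∃¬ n (λ u → adj G v u ≡ false) (λ u → adj G v u Bool.≟ false)
      λ nonadjacent → false≢true (trans (≡.sym ¬iso) (every-allFin⁺ (cong not ∘ nonadjacent))))

  isolated⊆core : isIsolated G ⊆ lookup (core G)
  isolated⊆core v iso = ¬-not λ v∉core →
    let P , (st , _ , ∣P∣) , Pv = ∉core⇒avoided v∉core
    in 1+n≰n (subst (λ k → suc k ≤ α G) ∣P∣ (extend-≤α st Pv (λ y _ → isolated⇒nonadjacent iso y)))

  isolated⇒0<numIsolated : ∀ {v} → isIsolated G v ≡ true → 0 < numIsolated G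
  isolated⇒0<numIsolated iso =
    subst (0 <_) (≡.sym numIsolated≡count) (count-pos {P = isIsolated G} iso)

  numIsolated≤ξ : numIsolated G ≤ ξ G
  numIsolated≤ξ = subst₂ _≤_ (≡.sym numIsolated≡count) (≡.sym ξ≡count) (count-mono isolated⊆core)

  -- The core of a bipartite graph

  2α≤n⇒colourClasses-Maximum : ∀ {c} → ProperColouring c → 2 * α G ≤ n →
                               Maximum c × Maximum (not ∘ c)
  2α≤n⇒colourClasses-Maximum {c} proper 2α≤n =
      (stA , (λ _ _ → refl) , m≤o∧n≤o∧o+o≤m+n⇒m≡o (Stable⇒≤α stA) (Stable⇒≤α stB) tight)
    , (stB , (λ _ _ → refl) , m≤o∧n≤o∧o+o≤m+n⇒m≡o (Stable⇒≤α stB) (Stable⇒≤α stA)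
                                (subst (α G + α G ≤_) (+-comm (count c) _) tight))
    where
    stA : Stable c
    stA = colourClass-Stable proper
    stB : Stable (not ∘ c)
    stB = colourClass-Stable (ProperColouring-not proper)
    tight : α G + α G ≤ count c + count (not ∘ c)
    tight = subst₂ _≤_ (2*m≡m+m (α G)) (≡.sym (count-complement c)) 2α≤n

  core-nonempty⇒n<2α : ∀ {c v} → ProperColouring c → lookup (core G) v ≡ true → n < 2 * α G
  core-nonempty⇒n<2α proper v∈core = ≰⇒> λ 2α≤n →
    let A-max , B-max = 2α≤n⇒colourClasses-Maximum proper 2α≤n
    in false≢true (trans (cong not (≡.sym (core⊆Maximum v∈core A-max))) (core⊆Maximum v∈core B-max))

  emptyCore⇒2α≤n : ∀ {c} → ProperColouring c → (∀ x → lookup (core G) x ≡ false) → 2 * α G ≤ n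
  emptyCore⇒2α≤n proper core≡∅ =
    subst (2 * α G ≤_) (count-full {n})
      (emptyCore⇒2a≤count {W = full} (λ st _ → Stable⇒≤α st) proper (proj₂ maximum-exists)
                          (λ {x} _ → ∉core⇒avoided (core≡∅ x)))

  closedNbhdᶜ⁻ : ∀ {v x} → closedNbhdᶜ v x ≡ true → x ≢ v × adj G v x ≡ false
  closedNbhdᶜ⁻ {v} e = Product.map₂ not-true⁻ (∈-remove⁻ {P = not ∘ adj G v} {v} e)

  closedNbhdᶜ⁺ : ∀ {v x} → x ≢ v → adj G v x ≡ false → closedNbhdᶜ v x ≡ true
  closedNbhdᶜ⁺ {v} x≢v vx = trans (remove-≢ (not ∘ adj G v) x≢v) (cong not vx)

  count-closedNbhdᶜ : ∀ {v u} → adj G v u ≡ true → 2 + count (closedNbhdᶜ v) ≤ n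
  count-closedNbhdᶜ {v} vu = begin
    2 + count (closedNbhdᶜ v)               ≡⟨ cong suc (count-remove (not ∘ adj G v) v∈) ⟩
    1 + count (not ∘ adj G v)               ≤⟨ +-monoˡ-≤ _ (count-pos {P = adj G v} vu) ⟩
    count (adj G v) + count (not ∘ adj G v) ≡⟨ count-complement (adj G v) ⟩
    n                                       ∎
    where
    open ≤-Reasoning
    v∈ : not (adj G v v) ≡ true
    v∈ = cong not (irrefl G v)

  closedNbhdᶜ-bounded : ∀ v {P} → Stable P → P ⊆ closedNbhdᶜ v → count P ≤ pred (α G)
  closedNbhdᶜ-bounded v {P} st P⊆ =
    suc[m]≤n⇒m≤pred[n] (extend-≤α st Pv (λ y Py → proj₂ (closedNbhdᶜ⁻ (P⊆ y Py))))
    where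
    Pv : P v ≡ false
    Pv = ¬-not λ Pv → proj₁ (closedNbhdᶜ⁻ (P⊆ v Pv)) refl

  module _ {v} (v∈core : lookup (core G) v ≡ true) where

    remove-Maximum : ∀ {T} → Maximum T → StableSubset (closedNbhdᶜ v) (pred (α G)) (remove v T)
    remove-Maximum {T} max@(st , _ , ∣T∣) =
        Stable-⊆ (remove-⊆ {P = T} {v}) st
      , (λ x ∈x → let x≢v , Tx = ∈-remove⁻ {P = T} ∈x
                  in closedNbhdᶜ⁺ x≢v (Stable⇒nonadjacent st Tv Tx))
      , cong pred (trans (count-remove T Tv) ∣T∣)
      where
      Tv : T v ≡ true
      Tv = core⊆Maximum v∈core max

    singletonCore⇒2α≤n : ∀ {c u} → ProperColouring c → adj G v u ≡ true →
                         (∀ x → lookup (core G) x ≡ true → x ≡ v) → 2 * α G ≤ n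
    singletonCore⇒2α≤n proper vu core⊆v = begin
      2 * α G                   ≡⟨ cong (2 *_) (suc-pred (α G) {{>-nonZero α-pos}}) ⟨
      2 * suc (pred (α G))      ≡⟨ *-suc 2 (pred (α G)) ⟩
      2 + 2 * pred (α G)        ≤⟨ +-monoʳ-≤ 2 (emptyCore⇒2a≤count (closedNbhdᶜ-bounded v) proper
                                                  (remove-Maximum max₀) avoid) ⟩
      2 + count (closedNbhdᶜ v) ≤⟨ count-closedNbhdᶜ vu ⟩
      n                         ∎
      where
      open ≤-Reasoning
      T₀ : Fin n → Bool
      T₀ = proj₁ maximum-exists
      max₀ : Maximum T₀
      max₀ = proj₂ maximum-exists
      α-pos : 0 < α G
      α-pos = subst (0 <_) (proj₂ (proj₂ max₀)) (count-pos {P = T₀} (core⊆Maximum v∈core max₀))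
      avoid : ∀ {x} → closedNbhdᶜ v x ≡ true →
              ∃ λ P → StableSubset (closedNbhdᶜ v) (pred (α G)) P × P x ≡ false
      avoid {x} ∈x =
        let x≢v , _      = closedNbhdᶜ⁻ ∈x
            T , max , Tx = ∉core⇒avoided (¬-not (x≢v ∘ core⊆v x))
        in remove v T , remove-Maximum max , trans (remove-≢ T x≢v) Tx

  ξ≤1⇒2α≤n : ∀ {c} → ProperColouring c → numIsolated G ≢ 1 → ξ G ≤ 1 → 2 * α G ≤ n
  ξ≤1⇒2α≤n proper ni ξ≤1 with n≤1⇒n≡0∨n≡1 ξ≤1
  ... | inj₁ ξ≡0 = emptyCore⇒2α≤n proper (count≡0⇒false (trans (≡.sym ξ≡count) ξ≡0))
  ... | inj₂ ξ≡1 with count≡1⇒singleton (trans (≡.sym ξ≡count) ξ≡1)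
  ...   | v , v∈core , core⊆v with isIsolated G v in iso
  ...     | true  = ⊥-elim (ni (≤-antisym (≤-trans numIsolated≤ξ ξ≤1) (isolated⇒0<numIsolated iso)))
  ...     | false = singletonCore⇒2α≤n v∈core proper (proj₂ (nonIsolated⇒neighbour iso)) core⊆v

proposition8 : (n : ℕ) (G : Graph n) → Bipartite G → numIsolated G ≢ 1 →
    (n < 2 * α G ⇔ 2 ≤ ξ G)
proposition8 n G (c , proper) ni = mk⇔ to from
  where
  to : n < 2 * α G → 2 ≤ ξ G
  to n<2α = ≰⇒> λ ξ≤1 → <⇒≱ n<2α (ξ≤1⇒2α≤n G proper ni ξ≤1)
  from : 2 ≤ ξ G → n < 2 * α G
  from 2≤ξ =
    let v , v∈core = count-witness (lookup (core G)) 0<ξ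
    in core-nonempty⇒n<2α G proper v∈core
    where
    0<ξ : 0 < count (lookup (core G))
    0<ξ = subst (0 <_) (ξ≡count G) (≤-trans (s≤s z≤n) 2≤ξ)
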